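{- Let $s$ be a fixed positive integer and let $n$ be a sufficiently large positive integer (depending on $s$). Let $v\in \widetilde{\mathbb{B}}_n$ and $S\subseteq \widetilde{\mathbb{B}}_n$ with $S\cap D(v)=\emptyset$ and $|S|=s$. Let $M$ be a full chain of $U(v)$ chosen uniformly at random among all $(n-|v|)!$ full chains of $U(v)$. Then $$\Pr\big(M\cap U^*(v,S)\neq\emptyset\big)\leq \frac{27 s\sqrt{n\ln n}}{n}.$$
   Context: $\mathbb{B}_n=(2^{[n]},\subseteq)$, whose elements (subsets of $[n]$) are called vertices; $|v|$ is the cardinality of $v$. $\widetilde{\mathbb{B}}_n=\{v\subseteq [n]: |v|\in [\frac n2-2\sqrt{n\ln n},\ \frac n2+2\sqrt{n\ln n}]\}$. For a vertex $v$, $D(v)=\{u\subseteq[n]: u\subseteq v\}$ and $U(v)=\{u\subseteq [n]: v\subseteq u\}$; for a set $S$ of vertices, $D(S)=\bigcup_{w\in S}D(w)$ and $U(S)=\bigcup_{w\in S}U(w)$. For $v\in\widetilde{\mathbb{B}}_n$ and $S\subseteq\widetilde{\mathbb{B}}_n$ with $S\cap D(v)=\emptyset$, $U^*(v,S)=\big[(U(v)\setminus\{v\})\cap (U(S)\cup D(S))\big]\cap \widetilde{\mathbb{B}}_n$. A full chain of $U(v)$ (a Boolean lattice of order $n-|v|$) is a chain $v=w_{|v|}\subset w_{|v|+1}\subset\dots\subset w_n=[n]$ with $|w_j|=j$; it is identified with its set of vertices. -}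

module Defs where

open import Data.Nat as ℕ using (ℕ; zero; suc; _∸_; ∣_-_∣)
open import Data.Bool using (Bool; true; false; _∧_)
open import Data.Vec using (Vec; []; _∷_)
open import Data.Vec.Properties using (≡-dec)
import Data.Bool.Properties as BoolP
open import Data.List using (List; []; _∷_; map; _++_; concatMap; filter; length)
open import Data.List.Membership.Propositional using (_∈_)
open import Data.List.Relation.Unary.Any using (Any)
open import Data.Fin.Subset using (Subset; inside; outside; ⊤; _⊆_; ∣_∣)
  renaming (_∈_ to _∈ₛ_)
open import Data.Fin.Subset.Properties using (_⊆?_)
open import Data.Product using (_×_; ∃-syntax)
open import Relation.Nullary using (¬_)
open import Relation.Nullary.Decidable using (⌊_⌋)
open import Relation.Binary.PropositionalEquality using (_≡_)
open import Data.Rational using (ℚ; 0ℚ; 1ℚ; _+_; _*_; _≤_; _/_)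
import Data.Integer as ℤ

-- 1/b as a rational (with the harmless convention 1/0 = 0)
recipℕ : ℕ → ℚ
recipℕ zero    = 0ℚ
recipℕ (suc b) = ℤ.+ 1 / suc b

fromℕ : ℕ → ℚ
fromℕ a = ℤ.+ a / 1

expTerm : ℚ → ℕ → ℚ
expTerm x zero    = 1ℚ
expTerm x (suc k) = expTerm x k * x * recipℕ (suc k)

expPartial : ℚ → ℕ → ℚ
expPartial x zero    = 1ℚ
expPartial x (suc N) = expPartial x N + expTerm x (suc N)

-- x ≤ ln n, for rational x ≥ 0 : exp x ≤ n, i.e. every partial sum of
-- the exponential series at x is ≤ n (partial sums increase to exp x).
_≤ln_ : ℚ → ℕ → Set
x ≤ln n = ∀ N → expPartial x N ≤ fromℕ n

-- v ∈ B̃_n  iff  |v| ∈ [n/2 - 2√(n ln n), n/2 + 2√(n ln n)]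
--          iff  (2|v| - n)² ≤ 16 n ln n
--          iff  (2|v| - n)² / (16 n) ≤ ln n         (n ≥ 1)
InWide : (n : ℕ) → Subset n → Set
InWide n v = (fromℕ (d ℕ.* d) * recipℕ (16 ℕ.* n)) ≤ln n
  where d = ∣ 2 ℕ.* ∣ v ∣ - n ∣

-- u ∈ U*(v,S) : u ∈ (U(v) \ {v}) ∩ (U(S) ∪ D(S)) ∩ B̃_n
InUStar : (n : ℕ) → Subset n → List (Subset n) → Subset n → Set
InUStar n v S u =
  (v ⊆ u) × ¬ (u ≡ v) ×
  (∃[ w ] (w ∈ S × ((w ⊆ u) Data.Sum.⊎ (u ⊆ w)))) × InWide n u
  where import Data.Sum

_==ₛ_ : ∀ {n} → Subset n → Subset n → Bool
p ==ₛ q = ⌊ ≡-dec BoolP._≟_ p q ⌋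

_⊆ᵇ_ : ∀ {n} → Subset n → Subset n → Bool
p ⊆ᵇ q = ⌊ p ⊆? q ⌋

chainRest : ∀ {n} → Subset n → List (Subset n) → Bool
chainRest prev []       = prev ==ₛ ⊤
chainRest prev (w ∷ ws) =
  (prev ⊆ᵇ w) ∧ (∣ w ∣ ℕ.≡ᵇ suc ∣ prev ∣) ∧ chainRest w ws

isFullChain : ∀ {n} → Subset n → List (Subset n) → Bool
isFullChain v []       = false
isFullChain v (w ∷ ws) = (w ==ₛ v) ∧ chainRest w ws

allSubsets : (n : ℕ) → List (Subset n)
allSubsets zero    = [] ∷ []
allSubsets (suc n) = map (outside ∷_) (allSubsets n) ++ map (inside ∷_) (allSubsets n)

allSeqs : (n k : ℕ) → List (List (Subset n))
allSeqs n zero    = [] ∷ []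
allSeqs n (suc k) = concatMap (λ w → map (w ∷_) (allSeqs n k)) (allSubsets n)

-- number of full chains of U(v) (every full chain has n - |v| + 1 vertices)
numFullChains : (n : ℕ) → Subset n → ℕ
numFullChains n v =
  length (filter (λ c → isFullChain v c Data.Bool.≟ true) (allSeqs n (suc (n ∸ ∣ v ∣))))
  where import Data.Bool

module Submission where

-- Encode a full chain of U(v) by the order σ in which it adds the elements outside v.  Let T bound
-- dist = ∣ 2∣u∣ − n ∣ on v, on S and on one vertex u ∈ U*(v,S) of each hitting chain; all of them are
-- wide, so T² / 16n ≤ ln n.  If w ⊆ u for some w ∈ S, the first element of w ∖ v is added within the
-- first ∣u∣ − ∣v∣ ≤ T steps; if u ⊆ w, the first added element lies in w ∖ v, of size at most T.
-- Either way the chain has a tag (x , i) with σᵢ = x from a list of at most 2T tags per w ∈ S.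
-- Transposing x with any z ∉ v turns σ into another full chain, from which the tag recovers z and
-- then σ; hence ∣L∣ (n − ∣v∣) ≤ 2sT · #chains.  The quadratic term of exp gives T⁴ ≤ 512 n³, so
-- T ≤ 11n/27 once n ≥ 20000, whence n − ∣v∣ ≥ 8n/27 and p² n / 729s² ≤ T² / 16n ≤ ln n for the
-- hitting probability p = ∣L∣ / #chains.

open import Data.Nat using (ℕ)
open import Data.Fin.Subset using (Subset)
open import Data.List using (List)

module Lists where

  open import Data.Nat using (suc; _+_; _*_; _≤_; z≤n; s≤s)
  open import Data.Nat.Properties using (≤-trans; ≤-reflexive; +-mono-≤)
  open import Data.List using ([]; _∷_; length; map; concatMap; cartesianProduct)
  open import Data.List.Properties using (length-++; length-map)
  open import Data.List.Relation.Unary.Any using (here; there; _─_)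
  open import Data.List.Relation.Unary.All using (All; []; _∷_; lookup; reduce)
  open import Data.List.Relation.Unary.Unique.Propositional using (Unique; _∷_)
  open import Data.List.Membership.Propositional using (_∈_)
  open import Data.Product using (∃-syntax; _×_; _,_)
  open import Relation.Binary.PropositionalEquality using (_≡_; _≢_; refl; sym; trans; cong; cong₂)
  open import Relation.Nullary using (contradiction)

  private
    variable
      A B : Set
      x y : A
      i : ℕ
      xs ys : List A

  ∈-─ : (p : x ∈ ys) → y ∈ ys → y ≢ x → y ∈ (ys ─ p)
  ∈-─ (here refl) (here refl) y≢x = contradiction refl y≢x
  ∈-─ (here _)    (there q)   _   = q
  ∈-─ (there p)   (here refl) _   = here refl
  ∈-─ (there p)   (there q)   y≢x = there (∈-─ p q y≢x)

  length-─ : (p : x ∈ ys) → length ys ≡ suc (length (ys ─ p))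
  length-─ (here _)  = refl
  length-─ (there p) = cong suc (length-─ p)

  injection⇒length≤ : (R : A → B → Set) → (∀ {x x′ y} → R x y → R x′ y → x ≡ x′) →
    Unique xs → (∀ {x} → x ∈ xs → ∃[ y ] y ∈ ys × R x y) → length xs ≤ length ys
  injection⇒length≤ {xs = []} R inj _ _ = z≤n
  injection⇒length≤ {xs = x ∷ xs} {ys} R inj (x∉xs ∷ xs!) image with image (here refl)
  ... | y , y∈ys , Rxy = ≤-trans (s≤s (injection⇒length≤ R inj xs! image′)) (≤-reflexive (sym (length-─ y∈ys)))
    where
    image′ : ∀ {x′} → x′ ∈ xs → ∃[ y′ ] y′ ∈ (ys ─ y∈ys) × R x′ y′
    image′ x′∈xs with image (there x′∈xs)
    ... | y′ , y′∈ys , Rx′y′ =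
      y′ , ∈-─ y∈ys y′∈ys (λ { refl → lookup x∉xs x′∈xs (inj Rxy Rx′y′) }) , Rx′y′

  length-cartesianProduct : (xs : List A) (ys : List B) →
    length (cartesianProduct xs ys) ≡ length xs * length ys
  length-cartesianProduct []       ys = refl
  length-cartesianProduct (x ∷ xs) ys =
    trans (length-++ (map (x ,_) ys)) (cong₂ _+_ (length-map (x ,_) ys) (length-cartesianProduct xs ys))

  length-concatMap-≤ : ∀ (f : A → List B) {k} xs → (∀ x → length (f x) ≤ k) →
    length (concatMap f xs) ≤ length xs * k
  length-concatMap-≤ f []       _ = z≤n
  length-concatMap-≤ f (x ∷ xs) bound =
    ≤-trans (≤-reflexive (length-++ (f x))) (+-mono-≤ (bound x) (length-concatMap-≤ f xs bound))

  module _ {P : A → Set} (f : ∀ {x} → P x → B) where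

    reduce⁺ : ∀ {Q : B → Set} → (∀ {x} (px : P x) → Q (f px)) → (pxs : All P xs) → All Q (reduce f pxs)
    reduce⁺ Qf []         = []
    reduce⁺ Qf (px ∷ pxs) = Qf px ∷ reduce⁺ Qf pxs

    ∈-reduce : (pxs : All P xs) (x∈xs : x ∈ xs) → f (lookup pxs x∈xs) ∈ reduce f pxs
    ∈-reduce (px ∷ pxs) (here refl)  = here refl
    ∈-reduce (px ∷ pxs) (there x∈xs) = there (∈-reduce pxs x∈xs)

  data _[_]=_ {A : Set} : List A → ℕ → A → Set where
    here  : (x ∷ xs) [ 0 ]= x
    there : ∀ {i} → xs [ i ]= y → (x ∷ xs) [ suc i ]= y

  []=-map : (f : A → B) → xs [ i ]= x → map f xs [ i ]= f x
  []=-map f here      = here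
  []=-map f (there p) = there ([]=-map f p)

  []=-functional : xs [ i ]= x → xs [ i ]= y → x ≡ y
  []=-functional here      here      = refl
  []=-functional (there p) (there q) = []=-functional p q

  []=⇒∈ : xs [ i ]= x → x ∈ xs
  []=⇒∈ here      = here refl
  []=⇒∈ (there p) = there ([]=⇒∈ p)

module Subsets where

  open import Data.Nat using (zero; suc; _+_; _*_; _≤_; s≤s) renaming (∣_-_∣ to ∣_-_∣′)
  open import Data.Nat.Properties
    using (suc-injective; ≤-reflexive; ≤-trans; <-irrefl; +-suc; *-cancelˡ-≤; +-monoʳ-≤; +-monoˡ-≤;
           m≤n+∣m-n∣; m≤n+∣n-m∣; module ≤-Reasoning)
  open import Data.Nat.Tactic.RingSolver using (solve-∀)
  open import Data.Fin using (Fin; zero; suc)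
  import Data.Fin.Properties as Fin
  open import Data.Fin.Subset using (inside; outside; _∈_; _∉_; _⊆_; _─_; ∣_∣)
  open import Data.Fin.Subset.Properties
    using (drop-there; drop-∷-⊆; p⊆q⇒∣p∣≤∣q∣; x∈p∧x∉q⇒x∈p─q; _∈?_)
  open import Data.List using ([]; _∷_; length; map)
  open import Data.List.Properties using (length-map)
  open import Data.List.Membership.Propositional using () renaming (_∈_ to _∈ₗ_)
  open import Data.List.Membership.Propositional.Properties using (∈-map⁺; ∈-map⁻)
  open import Data.List.Relation.Unary.Any using (here; there)
  open import Data.List.Relation.Unary.Unique.Propositional using (Unique; []; _∷_)
  import Data.List.Relation.Unary.All as All
  import Data.List.Relation.Unary.All.Properties as All
  import Data.List.Relation.Unary.Unique.Propositional.Properties as Unique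
  open import Data.Vec using ([]; _∷_; here; there)
  open import Data.Empty using (⊥-elim)
  open import Data.Product using (∃-syntax; _×_; _,_)
  open import Data.Sum using (_⊎_; inj₁; inj₂)
  open import Function using (_∘_)
  open import Relation.Binary.PropositionalEquality using (_≡_; _≢_; refl; sym; trans; cong; subst)
  open import Relation.Nullary using (¬_; contradiction; yes; no)

  private
    variable
      n : ℕ
      p q : Subset n
      x y : Fin n

  insert : Fin n → Subset n → Subset n
  insert zero    (_ ∷ p) = inside ∷ p
  insert (suc x) (b ∷ p) = b ∷ insert x p

  x∈insert : ∀ x (p : Subset n) → x ∈ insert x p
  x∈insert zero    (_ ∷ p) = here
  x∈insert (suc x) (_ ∷ p) = there (x∈insert x p)

  p⊆insert : ∀ x (p : Subset n) → p ⊆ insert x p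
  p⊆insert zero    (_ ∷ p) here      = here
  p⊆insert zero    (_ ∷ p) (there m) = there m
  p⊆insert (suc x) (_ ∷ p) here      = here
  p⊆insert (suc x) (_ ∷ p) (there m) = there (p⊆insert x p m)

  ∈-insert⁻ : ∀ x (p : Subset n) → y ∈ insert x p → y ≡ x ⊎ y ∈ p
  ∈-insert⁻ zero    (_ ∷ p) here      = inj₁ refl
  ∈-insert⁻ zero    (_ ∷ p) (there m) = inj₂ (there m)
  ∈-insert⁻ (suc x) (_ ∷ p) here      = inj₂ here
  ∈-insert⁻ (suc x) (_ ∷ p) (there m) with ∈-insert⁻ x p m
  ... | inj₁ refl = inj₁ refl
  ... | inj₂ y∈p  = inj₂ (there y∈p)

  ∣insert∣ : x ∉ p → ∣ insert x p ∣ ≡ suc ∣ p ∣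
  ∣insert∣ {x = zero}  {outside ∷ p} _   = refl
  ∣insert∣ {x = zero}  {inside ∷ p}  x∉p = contradiction here x∉p
  ∣insert∣ {x = suc x} {outside ∷ p} x∉p = ∣insert∣ (x∉p ∘ there)
  ∣insert∣ {x = suc x} {inside ∷ p}  x∉p = cong suc (∣insert∣ (x∉p ∘ there))

  +-∣insert∣ : ∀ k → x ∉ p → k + ∣ insert x p ∣ ≡ suc k + ∣ p ∣
  +-∣insert∣ {p = p} k x∉p = trans (cong (k +_) (∣insert∣ x∉p)) (+-suc k ∣ p ∣)

  ∉-insert⁺ : y ≢ x → y ∉ p → y ∉ insert x p
  ∉-insert⁺ {x = x} {p} y≢x y∉p y∈ with ∈-insert⁻ x p y∈
  ... | inj₁ y≡x = y≢x y≡x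
  ... | inj₂ y∈p = y∉p y∈p

  insert-injective : x ∉ p → y ∉ p → insert x p ≡ insert y p → x ≡ y
  insert-injective {x = x} {p} {y} x∉p y∉p eq
    with ∈-insert⁻ y p (subst (x ∈_) eq (x∈insert x p))
  ... | inj₁ x≡y = x≡y
  ... | inj₂ x∈p = contradiction x∈p x∉p

  p⊆q∧∣q∣≤∣p∣⇒p≡q : p ⊆ q → ∣ q ∣ ≤ ∣ p ∣ → p ≡ q
  p⊆q∧∣q∣≤∣p∣⇒p≡q {p = []}          {[]}          _   _         = refl
  p⊆q∧∣q∣≤∣p∣⇒p≡q {p = outside ∷ p} {outside ∷ q} p⊆q ∣q∣≤∣p∣ =
    cong (outside ∷_) (p⊆q∧∣q∣≤∣p∣⇒p≡q (drop-∷-⊆ p⊆q) ∣q∣≤∣p∣)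
  p⊆q∧∣q∣≤∣p∣⇒p≡q {p = inside ∷ p}  {inside ∷ q}  p⊆q (s≤s ∣q∣≤∣p∣) =
    cong (inside ∷_) (p⊆q∧∣q∣≤∣p∣⇒p≡q (drop-∷-⊆ p⊆q) ∣q∣≤∣p∣)
  p⊆q∧∣q∣≤∣p∣⇒p≡q {p = inside ∷ p}  {outside ∷ q} p⊆q _         with p⊆q here
  ... | ()
  p⊆q∧∣q∣≤∣p∣⇒p≡q {p = outside ∷ p} {inside ∷ q}  p⊆q ∣q∣≤∣p∣  =
    contradiction (≤-trans ∣q∣≤∣p∣ (p⊆q⇒∣p∣≤∣q∣ (drop-∷-⊆ p⊆q))) (<-irrefl refl)

  ⊆-cover : p ⊆ q → ∣ q ∣ ≡ suc ∣ p ∣ → ∃[ x ] x ∉ p × q ≡ insert x p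
  ⊆-cover {p = outside ∷ p} {inside ∷ q}  p⊆q ∣q∣≡ =
    zero , (λ ()) ,
    cong (inside ∷_) (sym (p⊆q∧∣q∣≤∣p∣⇒p≡q (drop-∷-⊆ p⊆q) (≤-reflexive (suc-injective ∣q∣≡))))
  ⊆-cover {p = outside ∷ p} {outside ∷ q} p⊆q ∣q∣≡ with ⊆-cover (drop-∷-⊆ p⊆q) ∣q∣≡
  ... | x , x∉p , refl = suc x , x∉p ∘ drop-there , refl
  ⊆-cover {p = inside ∷ p}  {inside ∷ q}  p⊆q ∣q∣≡ with ⊆-cover (drop-∷-⊆ p⊆q) (suc-injective ∣q∣≡)
  ... | x , x∉p , refl = suc x , x∉p ∘ drop-there , refl
  ⊆-cover {p = inside ∷ p}  {outside ∷ q} p⊆q _ with p⊆q here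
  ... | ()

  ∣p─q∣+∣q∣≡∣p∣ : q ⊆ p → ∣ p ─ q ∣ + ∣ q ∣ ≡ ∣ p ∣
  ∣p─q∣+∣q∣≡∣p∣ {q = []}          {[]}          _   = refl
  ∣p─q∣+∣q∣≡∣p∣ {q = inside ∷ q}  {inside ∷ p}  q⊆p =
    trans (+-suc ∣ p ─ q ∣ ∣ q ∣) (cong suc (∣p─q∣+∣q∣≡∣p∣ (drop-∷-⊆ q⊆p)))
  ∣p─q∣+∣q∣≡∣p∣ {q = outside ∷ q} {inside ∷ p}  q⊆p = cong suc (∣p─q∣+∣q∣≡∣p∣ (drop-∷-⊆ q⊆p))
  ∣p─q∣+∣q∣≡∣p∣ {q = outside ∷ q} {outside ∷ p} q⊆p = ∣p─q∣+∣q∣≡∣p∣ (drop-∷-⊆ q⊆p)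
  ∣p─q∣+∣q∣≡∣p∣ {q = inside ∷ q}  {outside ∷ p} q⊆p with q⊆p here
  ... | ()

  x∈p─q⇒x∉q : x ∈ p ─ q → x ∉ q
  x∈p─q⇒x∉q {p = _ ∷ _} {_ ∷ _}      (there x∈) (there x∈q) = x∈p─q⇒x∉q x∈ x∈q
  x∈p─q⇒x∉q {p = _ ∷ _} {inside ∷ _} ()          here

  elements : Subset n → List (Fin n)
  elements []            = []
  elements (inside ∷ p)  = zero ∷ map suc (elements p)
  elements (outside ∷ p) = map suc (elements p)

  ∈-elements⁺ : x ∈ p → x ∈ₗ elements p
  ∈-elements⁺ {p = inside ∷ p}  here      = here refl
  ∈-elements⁺ {p = inside ∷ p}  (there m) = there (∈-map⁺ suc (∈-elements⁺ m))
  ∈-elements⁺ {p = outside ∷ p} (there m) = ∈-map⁺ suc (∈-elements⁺ m)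

  ∈-elements⁻ : x ∈ₗ elements p → x ∈ p
  ∈-elements⁻ {p = inside ∷ p}  (here refl) = here
  ∈-elements⁻ {p = inside ∷ p}  (there m) with ∈-map⁻ suc m
  ... | _ , m′ , refl = there (∈-elements⁻ m′)
  ∈-elements⁻ {p = outside ∷ p} m with ∈-map⁻ suc m
  ... | _ , m′ , refl = there (∈-elements⁻ m′)

  length-elements : (p : Subset n) → length (elements p) ≡ ∣ p ∣
  length-elements []            = refl
  length-elements (inside ∷ p)  = cong suc (trans (length-map suc (elements p)) (length-elements p))
  length-elements (outside ∷ p) = trans (length-map suc (elements p)) (length-elements p)

  elements-unique : (p : Subset n) → Unique (elements p)
  elements-unique []            = []
  elements-unique (inside ∷ p)  =
    All.map⁺ (All.tabulate (λ _ ())) ∷ Unique.map⁺ Fin.suc-injective (elements-unique p)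
  elements-unique (outside ∷ p) = Unique.map⁺ Fin.suc-injective (elements-unique p)

  ⊈⇒elements─≡∷ : ¬ p ⊆ q → ∃[ x ] ∃[ xs ] elements (p ─ q) ≡ x ∷ xs
  ⊈⇒elements─≡∷ {p = p} {q} p⊈q with elements (p ─ q) in eq
  ... | x ∷ xs = x , xs , refl
  ... | []     = ⊥-elim (p⊈q p⊆q)
    where
    p⊆q : p ⊆ q
    p⊆q {x} x∈p with x ∈? q
    ... | yes x∈q = x∈q
    ... | no  x∉q with subst (x ∈ₗ_) eq (∈-elements⁺ (x∈p∧x∉q⇒x∈p─q x∈p x∉q))
    ...   | ()

  -- The quantity d of InWide: twice the distance of ∣ u ∣ from the middle rank n / 2.
  dist : Subset n → ℕ
  dist {n} u = ∣ 2 * ∣ u ∣ - n ∣′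

  2∣p∣≤n+dist : ∀ {n} (p : Subset n) → 2 * ∣ p ∣ ≤ n + dist p
  2∣p∣≤n+dist {n} p = m≤n+∣m-n∣ (2 * ∣ p ∣) n

  n≤2∣p∣+dist : ∀ {n} (p : Subset n) → n ≤ 2 * ∣ p ∣ + dist p
  n≤2∣p∣+dist {n} p = m≤n+∣n-m∣ n (2 * ∣ p ∣)

  ∣p∣≤∣q∣+T : ∀ {n} {p q : Subset n} {T} → dist p ≤ T → dist q ≤ T → ∣ p ∣ ≤ ∣ q ∣ + T
  ∣p∣≤∣q∣+T {n} {p} {q} {T} dp dq = *-cancelˡ-≤ 2 (begin
    2 * ∣ p ∣               ≤⟨ 2∣p∣≤n+dist p ⟩
    n + dist p              ≤⟨ +-monoʳ-≤ n dp ⟩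
    n + T                   ≤⟨ +-monoˡ-≤ T (n≤2∣p∣+dist q) ⟩
    2 * ∣ q ∣ + dist q + T  ≤⟨ +-monoˡ-≤ T (+-monoʳ-≤ (2 * ∣ q ∣) dq) ⟩
    2 * ∣ q ∣ + T + T       ≡⟨ regroup ∣ q ∣ T ⟩
    2 * (∣ q ∣ + T)         ∎)
    where
    open ≤-Reasoning
    regroup : ∀ a b → 2 * a + b + b ≡ 2 * (a + b)
    regroup = solve-∀

module FullChains {n : ℕ} where

  open import Defs using (isFullChain; chainRest; _⊆ᵇ_)
  open Subsets
  open Lists using (_[_]=_; here; there)
  open import Data.Nat using (suc; _+_; _≤_; _≡ᵇ_)
  open import Data.Nat.Properties using (≡ᵇ⇒≡; ≡⇒≡ᵇ)
  open import Data.Bool using (true; T)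
  open import Data.Bool.Properties using (T-≡; T-∧)
  import Data.Bool.Properties as Bool
  open import Data.Fin using (Fin)
  import Data.Fin as Fin
  open import Data.Fin.Subset using (_∈_; _∉_; _⊆_; ∣_∣)
  open import Data.Fin.Subset.Properties using (_⊆?_; p⊆q⇒∣p∣≤∣q∣; ∣⊤∣≡n; ∣p∣≡n⇒p≡⊤)
  open import Data.Vec.Properties using (≡-dec)
  open import Data.List using ([]; _∷_; length; map)
  open import Data.List.Properties using (∷-injective)
  open import Data.List.Membership.Propositional using () renaming (_∈_ to _∈ₗ_)
  open import Data.List.Relation.Unary.Any using (here; there)
  open import Data.List.Relation.Unary.All using (All; []; _∷_)
  import Data.List.Relation.Unary.All as All
  import Data.List.Relation.Unary.All.Properties as All
  open import Data.List.Relation.Unary.Unique.Propositional using (Unique; []; _∷_)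
  import Data.List.Relation.Unary.Unique.Propositional.Properties as Unique
  open import Data.Product using (∃-syntax; _×_; _,_; proj₁; proj₂)
  open import Function using (_∘_)
  open import Function.Bundles using (module Equivalence)
  open Equivalence using (to; from)
  open import Relation.Binary.PropositionalEquality using (_≡_; _≢_; refl; sym; trans; cong; subst)
  open import Relation.Nullary using (yes; no; contradiction)
  open import Relation.Nullary.Decidable using (toWitness; fromWitness)

  private
    variable
      p v : Subset n
      x : Fin n
      σ τ : List (Fin n)

  ascent : Subset n → List (Fin n) → List (Subset n)
  ascent p []      = []
  ascent p (x ∷ σ) = insert x p ∷ ascent (insert x p) σ

  -- A full chain of U(p) is encoded by the order σ in which it adds the elements of [n] ∖ p.
  chain : Subset n → List (Fin n) → List (Subset n)
  chain p σ = p ∷ ascent p σ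

  length-ascent : ∀ p (σ : List (Fin n)) → length (ascent p σ) ≡ length σ
  length-ascent p []      = refl
  length-ascent p (x ∷ σ) = cong suc (length-ascent (insert x p) σ)

  Fresh : Subset n → List (Fin n) → Set
  Fresh p σ = All (_∉ p) σ × Unique σ

  fresh-∷⁻ : Fresh p (x ∷ σ) → x ∉ p × Fresh (insert x p) σ
  fresh-∷⁻ (x∉p ∷ σ∉p , x∉σ ∷ σ!) =
    x∉p , All.zipWith (λ (x≢y , y∉p) → ∉-insert⁺ (x≢y ∘ sym) y∉p) (x∉σ , σ∉p) , σ!

  fresh-∷⁺ : x ∉ p → Fresh (insert x p) σ → Fresh p (x ∷ σ)
  fresh-∷⁺ {x = x} {p} x∉p (σ∉ , σ!) = x∉p ∷ All.map (_∘ p⊆insert x p) σ∉ , All.map x≢ σ∉ ∷ σ!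
    where
    x≢ : ∀ {y} → y ∉ insert x p → x ≢ y
    x≢ y∉ refl = y∉ (x∈insert x p)

  fresh-map : (f : Fin n → Fin n) → (∀ {x y} → f x ≡ f y → x ≡ y) → (∀ {x} → x ∉ p → f x ∉ p) →
    Fresh p σ → Fresh p (map f σ)
  fresh-map f f-inj f-∉ (σ∉ , σ!) = All.map⁺ (All.map f-∉ σ∉) , Unique.map⁺ f-inj σ!

  chainRest-ascent : Fresh p σ → length σ + ∣ p ∣ ≡ n → T (chainRest p (ascent p σ))
  chainRest-ascent {σ = []}    _     ∣p∣≡n = fromWitness (∣p∣≡n⇒p≡⊤ ∣p∣≡n)
  chainRest-ascent {p = p} {σ = x ∷ σ} fresh len with fresh-∷⁻ fresh
  ... | x∉p , fresh′ = from T-∧ (fromWitness {a? = p ⊆? insert x p} (p⊆insert x p) ,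
    from T-∧ (≡⇒≡ᵇ _ _ (∣insert∣ x∉p) , chainRest-ascent fresh′ (trans (+-∣insert∣ (length σ) x∉p) len)))

  chainRest⇒ascent : ∀ ws → T (chainRest p ws) →
    ∃[ σ ] Fresh p σ × length σ + ∣ p ∣ ≡ n × ws ≡ ascent p σ
  chainRest⇒ascent []       p≡⊤ with toWitness p≡⊤
  ... | refl = [] , ([] , []) , ∣⊤∣≡n n , refl
  chainRest⇒ascent {p = p} (w ∷ ws) rest with to (T-∧ {p ⊆ᵇ w}) rest
  ... | p⊆w , rest′ with to (T-∧ {∣ w ∣ ≡ᵇ suc ∣ p ∣}) rest′
  ... | ∣w∣≡ , rest″
    with ⊆-cover {p = p} {q = w} (toWitness {a? = p ⊆? w} p⊆w) (≡ᵇ⇒≡ ∣ w ∣ (suc ∣ p ∣) ∣w∣≡)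
  ... | x , x∉p , refl with chainRest⇒ascent {p = insert x p} ws rest″
  ... | σ , fresh , len , refl = x ∷ σ , fresh-∷⁺ x∉p fresh , trans (sym (+-∣insert∣ (length σ) x∉p)) len , refl

  isFullChain-chain : Fresh v σ → length σ + ∣ v ∣ ≡ n → isFullChain v (chain v σ) ≡ true
  isFullChain-chain {v = v} fresh len =
    to T-≡ (from T-∧ (fromWitness {a? = ≡-dec Bool._≟_ v v} refl , chainRest-ascent fresh len))

  isFullChain⇒chain : ∀ {c} → isFullChain v c ≡ true →
    ∃[ σ ] Fresh v σ × length σ + ∣ v ∣ ≡ n × c ≡ chain v σ
  isFullChain⇒chain {v = v} {c = w ∷ ws} full with to T-∧ (from T-≡ full)
  ... | w≡v , rest with toWitness {a? = ≡-dec Bool._≟_ w v} w≡v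
  ... | refl with chainRest⇒ascent ws rest
  ... | σ , fresh , len , refl = σ , fresh , len , refl

  chain-injective : Fresh p σ → Fresh p τ → chain p σ ≡ chain p τ → σ ≡ τ
  chain-injective {σ = []}    {τ = []}    _ _ _ = refl
  chain-injective {p = p} {σ = x ∷ σ} {τ = y ∷ τ} freshσ freshτ eq
    with fresh-∷⁻ freshσ | fresh-∷⁻ freshτ | ∷-injective (proj₂ (∷-injective eq))
  ... | x∉p , freshσ′ | y∉p , freshτ′ | eq₁ , _ with insert-injective x∉p y∉p eq₁
  ... | refl = cong (x ∷_) (chain-injective freshσ′ freshτ′ (proj₂ (∷-injective eq)))

  chain-⊇ : ∀ {u} → u ∈ₗ chain p σ → p ⊆ u
  chain-⊇                 (here refl) = λ x∈p → x∈p
  chain-⊇ {p = p} {x ∷ σ} (there u∈) = chain-⊇ u∈ ∘ p⊆insert x p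

  chain-head : ∀ {u} → u ∈ₗ chain p σ → u ≢ p → ∃[ x ] σ [ 0 ]= x × x ∈ u
  chain-head             (here refl) u≢p = contradiction refl u≢p
  chain-head {p = p} {x ∷ σ} (there u∈) _ = x , here , chain-⊇ u∈ (x∈insert x p)

  chain-position : ∀ {u} → Fresh p σ → u ∈ₗ chain p σ → x ∈ u → x ∉ p →
    ∃[ i ] σ [ i ]= x × suc i + ∣ p ∣ ≤ ∣ u ∣
  chain-position _ (here refl) x∈u x∉p = contradiction x∈u x∉p
  chain-position {p = p} {y ∷ σ} {x} {u} fresh (there u∈) x∈u x∉p with fresh-∷⁻ fresh | x Fin.≟ y
  ... | y∉p , _ | yes refl =
    0 , here , subst (_≤ ∣ u ∣) (∣insert∣ y∉p) (p⊆q⇒∣p∣≤∣q∣ (chain-⊇ u∈))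
  ... | y∉p , fresh′ | no x≢y with chain-position fresh′ u∈ x∈u (∉-insert⁺ x≢y x∉p)
  ... | i , σ[i]=x , rank = suc i , there σ[i]=x , subst (_≤ ∣ u ∣) (+-∣insert∣ (suc i) y∉p) rank

module Transpositions {n : ℕ} where

  open import Data.Fin using (Fin; _≟_)
  open import Data.Fin.Permutation.Components using (transpose; transpose-inverse)
  open import Data.Bool using (true; false)
  open import Relation.Nullary using (does)
  open import Relation.Nullary.Decidable using (dec-true)
  open import Relation.Binary.PropositionalEquality using (_≡_; refl; sym; trans; cong)

  transpose-injective : ∀ (i j : Fin n) {k l} → transpose i j k ≡ transpose i j l → k ≡ l
  transpose-injective i j {k} {l} eq =
    trans (sym (transpose-inverse j i)) (trans (cong (transpose j i) eq) (transpose-inverse j i))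

  transpose-ij : ∀ (i j : Fin n) → transpose i j i ≡ j
  transpose-ij i j rewrite dec-true (i ≟ i) refl = refl

  transpose-closed : ∀ (P : Fin n → Set) {i j k} → P i → P j → P k → P (transpose i j k)
  transpose-closed P {i} {j} {k} pi pj pk with does (k ≟ i)
  ... | true  = pj
  ... | false with does (k ≟ j)
  ...   | true  = pi
  ...   | false = pk

module Enumerations where

  open import Defs using (allSubsets; allSeqs)
  open import Data.Nat using (zero; suc)
  open import Data.Nat.Properties using (suc-injective)
  open import Data.Fin.Subset using (inside; outside)
  open import Data.Vec using ([]; _∷_)
  open import Data.List using ([]; _∷_; map; length)
  open import Data.List.Membership.Propositional using (_∈_; lose)
  open import Data.List.Membership.Propositional.Properties using (∈-map⁺; ∈-++⁺ˡ; ∈-++⁺ʳ; ∈-concatMap⁺)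
  open import Data.List.Relation.Unary.Any using (here)
  open import Relation.Binary.PropositionalEquality using (_≡_; refl)

  ∈-allSubsets : ∀ {n} (p : Subset n) → p ∈ allSubsets n
  ∈-allSubsets []            = here refl
  ∈-allSubsets (outside ∷ p) = ∈-++⁺ˡ (∈-map⁺ (outside ∷_) (∈-allSubsets p))
  ∈-allSubsets {suc n} (inside ∷ p) =
    ∈-++⁺ʳ (map (outside ∷_) (allSubsets n)) (∈-map⁺ (inside ∷_) (∈-allSubsets p))

  ∈-allSeqs : ∀ {n} k (c : List (Subset n)) → length c ≡ k → c ∈ allSeqs n k
  ∈-allSeqs zero    []      refl = here refl
  ∈-allSeqs {n} (suc k) (w ∷ c) len  =
    ∈-concatMap⁺ (λ w → map (w ∷_) (allSeqs n k))
      (lose (∈-allSubsets w) (∈-map⁺ (w ∷_) (∈-allSeqs k c (suc-injective len))))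

module HittingChains {n : ℕ} (v : Subset n) (S : List (Subset n)) (T : ℕ) where

  open import Defs using (isFullChain; numFullChains; allSeqs)
  open Lists
  open Subsets
  open FullChains
  open Transpositions
  open Enumerations
  open import Data.Nat using (suc; _+_; _*_; _∸_; _≤_; _<_; z≤n)
  open import Data.Nat.Properties
    using (≤-trans; ≤-reflexive; +-comm; +-cancelʳ-≤; *-monoˡ-≤; m+n∸n≡m; +-mono-≤; m⊓n≤m; module ≤-Reasoning)
  open import Data.Bool using (true)
  import Data.Bool as Bool
  open import Data.Fin using (Fin)
  open import Data.Fin.Permutation.Components using (transpose)
  open import Data.Fin.Subset using (∁; _∉_; _⊆_; _─_; ∣_∣)
  open import Data.Fin.Subset.Properties using (x∈p∧x∉q⇒x∈p─q; p─q⊆p; x∈∁p⇒x∉p; ∣∁p∣≡n∸∣p∣)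
  open import Data.List using ([]; _∷_; length; map; _++_; take; upTo; concatMap; filter; cartesianProduct)
  open import Data.List.Properties using (length-map; length-++; length-take; take-all; length-upTo; map-injective)
  open import Data.List.Membership.Propositional using (lose) renaming (_∈_ to _∈ₗ_)
  open import Data.List.Membership.Propositional.Properties
    using (∈-map⁺; ∈-++⁺ˡ; ∈-++⁺ʳ; ∈-upTo⁺; ∈-concatMap⁺; ∈-filter⁺; ∈-cartesianProduct⁺; ∈-cartesianProduct⁻)
  open import Data.List.Relation.Unary.Any using (here)
  open import Data.List.Relation.Unary.All using (All)
  import Data.List.Relation.Unary.All as All
  open import Data.List.Relation.Unary.Unique.Propositional using (Unique)
  import Data.List.Relation.Unary.Unique.Propositional.Properties as Unique
  open import Data.Product using (∃-syntax; _×_; _,_; proj₁)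
  open import Data.Sum using (_⊎_; [_,_]′)
  open import Function using (_∘_)
  open import Relation.Binary.PropositionalEquality
    using (_≡_; _≢_; refl; sym; trans; cong; cong₂; subst; module ≡-Reasoning)
  open import Relation.Nullary using (¬_)

  leadTags : List (Fin n) → List (Fin n × ℕ)
  leadTags []      = []
  leadTags (x ∷ _) = map (x ,_) (upTo T)

  -- A tag (x , i) says that x is added at step i of a chain.  The tags of w are (x₀ , i) for i < T,
  -- x₀ the first element of w ∖ v, and (x , 0) for x among the first T elements of w ∖ v.
  tags : Subset n → List (Fin n × ℕ)
  tags w = leadTags (elements (w ─ v)) ++ map (_, 0) (take T (elements (w ─ v)))

  length-tags : ∀ w → length (tags w) ≤ T + T
  length-tags w = ≤-trans (≤-reflexive (length-++ (leadTags ds)))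
    (+-mono-≤ (length-leadTags ds)
              (≤-trans (≤-reflexive (trans (length-map (_, 0) (take T ds)) (length-take T ds))) (m⊓n≤m T _)))
    where
    ds = elements (w ─ v)
    length-leadTags : ∀ xs → length (leadTags xs) ≤ T
    length-leadTags []      = z≤n
    length-leadTags (x ∷ _) = ≤-reflexive (trans (length-map (x ,_) (upTo T)) (length-upTo T))

  Tagged : List (Fin n) → Fin n × ℕ → Set
  Tagged σ (x , i) = σ [ i ]= x

  -- c meets U*(v,S) at a vertex u with dist u ≤ T (along a chain of U(v), v ⊆ u is automatic).
  Hit : List (Subset n) → Set
  Hit c = ∃[ u ] u ∈ₗ c × u ≢ v × dist u ≤ T × ∃[ w ] w ∈ₗ S × (w ⊆ u ⊎ u ⊆ w)

  fullChains : List (List (Subset n))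
  fullChains = filter (λ c → isFullChain v c Bool.≟ true) (allSeqs n (suc (n ∸ ∣ v ∣)))

  chain-∈-fullChains : ∀ {σ} → Fresh v σ → length σ + ∣ v ∣ ≡ n → chain v σ ∈ₗ fullChains
  chain-∈-fullChains {σ} fresh len =
    ∈-filter⁺ (λ c → isFullChain v c Bool.≟ true) (∈-allSeqs _ (chain v σ) (cong suc steps))
      (isFullChain-chain fresh len)
    where
    steps : length (ascent v σ) ≡ n ∸ ∣ v ∣
    steps = trans (length-ascent v σ) (trans (sym (m+n∸n≡m (length σ) ∣ v ∣)) (cong (_∸ ∣ v ∣) len))

  Swapped : List (Subset n) × Fin n → (Fin n × ℕ) × List (Subset n) → Set
  Swapped (c , z) ((y , i) , c′) = ∃[ σ ] c ≡ chain v σ × σ [ i ]= y ×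
    Fresh v (map (transpose y z) σ) × c′ ≡ chain v (map (transpose y z) σ)

  -- Position i of the swapped sequence holds z, so z and then c can be read off c′.
  Swapped-injective : ∀ {a a′ b} → Swapped a b → Swapped a′ b → a ≡ a′
  Swapped-injective {c₁ , z₁} {c₂ , z₂} {(y , i) , c′}
    (σ₁ , refl , σ₁[i]=y , fresh₁ , c′≡₁) (σ₂ , refl , σ₂[i]=y , fresh₂ , c′≡₂) =
    cong₂ _,_ (cong (chain v) σ₁≡σ₂) z₁≡z₂
    where
    swaps≡ : map (transpose y z₁) σ₁ ≡ map (transpose y z₂) σ₂
    swaps≡ = chain-injective fresh₁ fresh₂ (trans (sym c′≡₁) c′≡₂)
    z₁≡z₂ : z₁ ≡ z₂
    z₁≡z₂ = begin
      z₁                  ≡⟨ transpose-ij y z₁ ⟨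
      transpose y z₁ y    ≡⟨ []=-functional ([]=-map (transpose y z₁) σ₁[i]=y)
                               (subst (_[ i ]= transpose y z₂ y) (sym swaps≡) ([]=-map (transpose y z₂) σ₂[i]=y)) ⟩
      transpose y z₂ y    ≡⟨ transpose-ij y z₂ ⟩
      z₂                  ∎
      where open ≡-Reasoning
    σ₁≡σ₂ : σ₁ ≡ σ₂
    σ₁≡σ₂ = map-injective (transpose-injective y z₁)
      (trans swaps≡ (cong (λ z → map (transpose y z) σ₂) (sym z₁≡z₂)))

  module _ (v-near : dist v ≤ T) (S-near : All (λ w → dist w ≤ T) S) (S⊈v : All (λ w → ¬ w ⊆ v) S) where

    tag-via-w⊆u : ∀ {σ u w} → Fresh v σ → u ∈ₗ chain v σ → dist u ≤ T → ¬ w ⊆ v → w ⊆ u →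
      ∃[ t ] t ∈ₗ tags w × Tagged σ t
    tag-via-w⊆u {σ} {u} {w} fresh u∈ du w⊈v w⊆u with ⊈⇒elements─≡∷ w⊈v
    ... | x , xs , eq with ∈-elements⁻ (subst (x ∈ₗ_) (sym eq) (here refl))
    ... | x∈w─v with chain-position fresh u∈ (w⊆u (p─q⊆p w v x∈w─v)) (x∈p─q⇒x∉q x∈w─v)
    ... | i , σ[i]=x , rank = (x , i) , ∈-++⁺ˡ lead , σ[i]=x
      where
      i<T : i < T
      i<T = +-cancelʳ-≤ ∣ v ∣ (suc i) T
        (≤-trans rank (≤-trans (∣p∣≤∣q∣+T {p = u} {q = v} du v-near) (≤-reflexive (+-comm ∣ v ∣ T))))
      lead : (x , i) ∈ₗ leadTags (elements (w ─ v))
      lead = subst (λ ds → (x , i) ∈ₗ leadTags ds) (sym eq) (∈-map⁺ (x ,_) (∈-upTo⁺ i<T))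

    tag-via-u⊆w : ∀ {σ u w} → Fresh v σ → u ∈ₗ chain v σ → u ≢ v → dist w ≤ T → u ⊆ w →
      ∃[ t ] t ∈ₗ tags w × Tagged σ t
    tag-via-u⊆w {σ} {u} {w} fresh u∈ u≢v dw u⊆w with chain-head u∈ u≢v
    ... | x , σ[0]=x , x∈u = (x , 0) , ∈-++⁺ʳ (leadTags ds) (∈-map⁺ (_, 0) x∈take) , σ[0]=x
      where
      open ≤-Reasoning
      ds = elements (w ─ v)
      x∉v : x ∉ v
      x∉v = All.lookup (proj₁ fresh) ([]=⇒∈ σ[0]=x)
      v⊆w : v ⊆ w
      v⊆w = u⊆w ∘ chain-⊇ u∈
      short : length ds ≤ T
      short = +-cancelʳ-≤ ∣ v ∣ (length ds) T (begin
        length ds + ∣ v ∣   ≡⟨ cong (_+ ∣ v ∣) (length-elements (w ─ v)) ⟩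
        ∣ w ─ v ∣ + ∣ v ∣   ≡⟨ ∣p─q∣+∣q∣≡∣p∣ v⊆w ⟩
        ∣ w ∣               ≤⟨ ∣p∣≤∣q∣+T {p = w} {q = v} dw v-near ⟩
        ∣ v ∣ + T           ≡⟨ +-comm ∣ v ∣ T ⟩
        T + ∣ v ∣           ∎)
      x∈take : x ∈ₗ take T ds
      x∈take = subst (x ∈ₗ_) (sym (take-all T ds short)) (∈-elements⁺ (x∈p∧x∉q⇒x∈p─q (u⊆w x∈u) x∉v))

    tag-exists : ∀ {σ} → Fresh v σ → Hit (chain v σ) → ∃[ t ] t ∈ₗ concatMap tags S × Tagged σ t
    tag-exists fresh (u , u∈ , u≢v , du , w , w∈S , comparable) =
      let t , t∈tags , tagged = [ tag-via-w⊆u fresh u∈ du (All.lookup S⊈v w∈S)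
                                , tag-via-u⊆w fresh u∈ u≢v (All.lookup S-near w∈S) ]′ comparable
      in t , ∈-concatMap⁺ tags (lose w∈S t∈tags) , tagged

    hitting-count : ∀ {L} → Unique L → All (λ c → isFullChain v c ≡ true × Hit c) L →
      length L * (n ∸ ∣ v ∣) ≤ length S * (T + T) * numFullChains n v
    hitting-count {L} L! hits = begin
      length L * (n ∸ ∣ v ∣)
        ≡⟨ cong (length L *_) (trans (length-elements (∁ v)) (∣∁p∣≡n∸∣p∣ v)) ⟨
      length L * length zs
        ≡⟨ length-cartesianProduct L zs ⟨
      length (cartesianProduct L zs)
        ≤⟨ injection⇒length≤ Swapped Swapped-injective (Unique.cartesianProduct⁺ L! (elements-unique (∁ v))) swap ⟩
      length (cartesianProduct (concatMap tags S) fullChains)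
        ≡⟨ length-cartesianProduct (concatMap tags S) fullChains ⟩
      length (concatMap tags S) * numFullChains n v
        ≤⟨ *-monoˡ-≤ (numFullChains n v) (length-concatMap-≤ tags S length-tags) ⟩
      length S * (T + T) * numFullChains n v ∎
      where
      open ≤-Reasoning
      zs = elements (∁ v)
      swap : ∀ {a} → a ∈ₗ cartesianProduct L zs →
        ∃[ b ] b ∈ₗ cartesianProduct (concatMap tags S) fullChains × Swapped a b
      swap {c , z} a∈ with ∈-cartesianProduct⁻ L zs a∈
      ... | c∈L , z∈zs with All.lookup hits c∈L
      ... | full , hit with isFullChain⇒chain {v = v} {c = c} full
      ... | σ , fresh , len , refl with tag-exists fresh hit
      ... | (y , i) , t∈ , σ[i]=y =
        ((y , i) , chain v σ′) , ∈-cartesianProduct⁺ t∈ (chain-∈-fullChains fresh′ len′) ,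
        σ , refl , σ[i]=y , fresh′ , refl
        where
        σ′ = map (transpose y z) σ
        y∉v : y ∉ v
        y∉v = All.lookup (proj₁ fresh) ([]=⇒∈ σ[i]=y)
        z∉v : z ∉ v
        z∉v = x∈∁p⇒x∉p (∈-elements⁻ z∈zs)
        fresh′ : Fresh v σ′
        fresh′ = fresh-map (transpose y z) (transpose-injective y z) (transpose-closed (_∉ v) y∉v z∉v) fresh
        len′ : length σ′ + ∣ v ∣ ≡ n
        len′ = trans (cong (_+ ∣ v ∣) (length-map (transpose y z) σ)) len

module Fractions where

  open import Defs using (fromℕ; recipℕ)
  open import Data.Nat as ℕ using (zero; suc; NonZero; z≤n)
  import Data.Nat.Properties as ℕ
  open import Data.Integer as ℤ using (+_)
  import Data.Integer.Properties as ℤ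
  open import Data.Rational using (ℚ; 0ℚ; _*_; _≤_; toℚᵘ)
  open import Data.Rational.Properties
    using (*-identityˡ; *-identityʳ; *-zeroˡ; *-zeroʳ; toℚᵘ-homo-*; toℚᵘ-fromℚᵘ; toℚᵘ-injective;
           toℚᵘ-mono-≤; toℚᵘ-cancel-≤; ≤-reflexive)
  open import Data.Rational.Unnormalised as ℚᵘ using (mkℚᵘ; *≤*)
  import Data.Rational.Unnormalised.Properties as ℚᵘ
  open import Relation.Binary.PropositionalEquality using (_≡_; sym; cong; cong₂; subst; subst₂; module ≡-Reasoning)

  frac : ℕ → ℕ → ℚ
  frac a b = fromℕ a * recipℕ b

  fromℕ≡frac : ∀ a → fromℕ a ≡ frac a 1
  fromℕ≡frac a = sym (*-identityʳ (fromℕ a))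

  recipℕ≡frac : ∀ b → recipℕ b ≡ frac 1 b
  recipℕ≡frac b = sym (*-identityˡ (recipℕ b))

  frac-zero : ∀ a → frac a 0 ≡ 0ℚ
  frac-zero a = *-zeroʳ (fromℕ a)

  toℚᵘ-frac : ∀ a b → toℚᵘ (frac a (suc b)) ℚᵘ.≃ mkℚᵘ (+ a) b
  toℚᵘ-frac a b = ℚᵘ.≃-trans (toℚᵘ-homo-* (fromℕ a) (recipℕ (suc b)))
    (ℚᵘ.≃-trans (ℚᵘ.*-cong (toℚᵘ-fromℚᵘ (mkℚᵘ (+ a) 0)) (toℚᵘ-fromℚᵘ (mkℚᵘ (+ 1) b)))
      (ℚᵘ.≃-reflexive (cong₂ mkℚᵘ (ℤ.*-identityʳ (+ a)) (ℕ.+-identityʳ b))))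

  frac-* : ∀ a b c d → frac a b * frac c d ≡ frac (a ℕ.* c) (b ℕ.* d)
  frac-* a zero c d = begin
    frac a 0 * frac c d ≡⟨ cong (_* frac c d) (frac-zero a) ⟩
    0ℚ * frac c d       ≡⟨ *-zeroˡ (frac c d) ⟩
    0ℚ                  ≡⟨ frac-zero (a ℕ.* c) ⟨
    frac (a ℕ.* c) 0    ∎
    where open ≡-Reasoning
  frac-* a (suc b) c zero = begin
    frac a (suc b) * frac c 0     ≡⟨ cong (frac a (suc b) *_) (frac-zero c) ⟩
    frac a (suc b) * 0ℚ           ≡⟨ *-zeroʳ (frac a (suc b)) ⟩
    0ℚ                            ≡⟨ frac-zero (a ℕ.* c) ⟨
    frac (a ℕ.* c) 0              ≡⟨ cong (frac (a ℕ.* c)) (ℕ.*-zeroʳ (suc b)) ⟨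
    frac (a ℕ.* c) (suc b ℕ.* 0)  ∎
    where open ≡-Reasoning
  frac-* a (suc b) c (suc d) = toℚᵘ-injective (begin
    toℚᵘ (frac a (suc b) * frac c (suc d))            ≈⟨ toℚᵘ-homo-* (frac a (suc b)) (frac c (suc d)) ⟩
    toℚᵘ (frac a (suc b)) ℚᵘ.* toℚᵘ (frac c (suc d))  ≈⟨ ℚᵘ.*-cong (toℚᵘ-frac a b) (toℚᵘ-frac c d) ⟩
    mkℚᵘ (+ a) b ℚᵘ.* mkℚᵘ (+ c) d                   ≡⟨ cong (λ i → mkℚᵘ i _) (ℤ.pos-* a c) ⟨
    mkℚᵘ (+ (a ℕ.* c)) (d ℕ.+ b ℕ.* suc d)             ≈⟨ toℚᵘ-frac (a ℕ.* c) _ ⟨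
    toℚᵘ (frac (a ℕ.* c) (suc b ℕ.* suc d))           ∎)
    where open ℚᵘ.≃-Reasoning

  private
    frac-≤⁺-suc : ∀ {a b c d} → a ℕ.* suc d ℕ.≤ c ℕ.* suc b → frac a (suc b) ≤ frac c (suc d)
    frac-≤⁺-suc {a} {b} {c} {d} ad≤cb = toℚᵘ-cancel-≤
      (ℚᵘ.≤-respʳ-≃ (ℚᵘ.≃-sym (toℚᵘ-frac c d)) (ℚᵘ.≤-respˡ-≃ (ℚᵘ.≃-sym (toℚᵘ-frac a b))
        (*≤* (subst₂ ℤ._≤_ (ℤ.pos-* a (suc d)) (ℤ.pos-* c (suc b)) (ℤ.+≤+ ad≤cb)))))

  frac-nonNeg : ∀ a b → 0ℚ ≤ frac a b
  frac-nonNeg a zero    = ≤-reflexive (sym (frac-zero a))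
  frac-nonNeg a (suc b) = frac-≤⁺-suc {0} {0} {a} {b} z≤n

  frac-≤⁺ : ∀ {a b c d} .{{_ : NonZero d}} → a ℕ.* d ℕ.≤ c ℕ.* b → frac a b ≤ frac c d
  frac-≤⁺ {a} {zero}  {c} {d}     _ = subst (_≤ frac c d) (sym (frac-zero a)) (frac-nonNeg c d)
  frac-≤⁺ {a} {suc b} {c} {suc d}   = frac-≤⁺-suc {a} {b} {c} {d}

  frac-≤⁻ : ∀ {a b c d} .{{_ : NonZero b}} .{{_ : NonZero d}} → frac a b ≤ frac c d → a ℕ.* d ℕ.≤ c ℕ.* b
  frac-≤⁻ {a} {suc b} {c} {suc d} p
    with ℚᵘ.≤-respʳ-≃ (toℚᵘ-frac c d) (ℚᵘ.≤-respˡ-≃ (toℚᵘ-frac a b) (toℚᵘ-mono-≤ p))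
  ... | *≤* ad≤cb = ℤ.drop‿+≤+ (subst₂ ℤ._≤_ (sym (ℤ.pos-* a (suc d))) (sym (ℤ.pos-* c (suc b))) ad≤cb)

module ExponentialSeries where

  open import Defs using (fromℕ; recipℕ; expTerm; expPartial; _≤ln_)
  open Fractions
  open import Data.Nat using (zero; suc)
  open import Data.Rational using (ℚ; 0ℚ; 1ℚ; _*_; _≤_; nonNegative)
  open import Data.Rational.Properties
    using (≤-refl; ≤-trans; +-mono-≤; +-identityˡ; *-identityˡ; *-identityʳ;
           *-monoˡ-≤-nonNeg; *-monoʳ-≤-nonNeg; nonNeg*nonNeg⇒nonNeg; nonNegative⁻¹)
  open import Relation.Binary.PropositionalEquality using (_≡_; sym; trans; cong; subst)

  private
    variable
      x y : ℚ

  *-nonNeg : 0ℚ ≤ x → 0ℚ ≤ y → 0ℚ ≤ x * y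
  *-nonNeg {x} {y} 0≤x 0≤y =
    nonNegative⁻¹ _ {{nonNeg*nonNeg⇒nonNeg x {{nonNegative 0≤x}} y {{nonNegative 0≤y}}}}

  *-mono-≤-nonNeg : ∀ {u w} → 0ℚ ≤ x → x ≤ y → 0ℚ ≤ u → u ≤ w → x * u ≤ y * w
  *-mono-≤-nonNeg {x} {y} {u} {w} 0≤x x≤y 0≤u u≤w =
    ≤-trans (*-monoʳ-≤-nonNeg u {{nonNegative 0≤u}} x≤y)
            (*-monoˡ-≤-nonNeg y {{nonNegative (≤-trans 0≤x x≤y)}} u≤w)

  recipℕ-nonNeg : ∀ b → 0ℚ ≤ recipℕ b
  recipℕ-nonNeg b = subst (0ℚ ≤_) (sym (recipℕ≡frac b)) (frac-nonNeg 1 b)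

  expTerm-nonNeg : 0ℚ ≤ x → ∀ k → 0ℚ ≤ expTerm x k
  expTerm-nonNeg 0≤x zero    = nonNegative⁻¹ 1ℚ
  expTerm-nonNeg 0≤x (suc k) = *-nonNeg (*-nonNeg (expTerm-nonNeg 0≤x k) 0≤x) (recipℕ-nonNeg (suc k))

  expPartial-nonNeg : 0ℚ ≤ x → ∀ k → 0ℚ ≤ expPartial x k
  expPartial-nonNeg 0≤x zero    = nonNegative⁻¹ 1ℚ
  expPartial-nonNeg 0≤x (suc k) =
    +-mono-≤ (expPartial-nonNeg 0≤x k) (expTerm-nonNeg 0≤x (suc k))

  expTerm-mono-≤ : 0ℚ ≤ x → x ≤ y → ∀ k → expTerm x k ≤ expTerm y k
  expTerm-mono-≤ 0≤x x≤y zero    = ≤-refl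
  expTerm-mono-≤ 0≤x x≤y (suc k) =
    *-mono-≤-nonNeg (*-nonNeg (expTerm-nonNeg 0≤x k) 0≤x)
      (*-mono-≤-nonNeg (expTerm-nonNeg 0≤x k) (expTerm-mono-≤ 0≤x x≤y k) 0≤x x≤y)
      (recipℕ-nonNeg (suc k)) ≤-refl

  expPartial-mono-≤ : 0ℚ ≤ x → x ≤ y → ∀ k → expPartial x k ≤ expPartial y k
  expPartial-mono-≤ 0≤x x≤y zero    = ≤-refl
  expPartial-mono-≤ 0≤x x≤y (suc k) =
    +-mono-≤ (expPartial-mono-≤ 0≤x x≤y k) (expTerm-mono-≤ 0≤x x≤y (suc k))

  ≤-≤ln-trans : ∀ {n} → 0ℚ ≤ x → x ≤ y → y ≤ln n → x ≤ln n
  ≤-≤ln-trans 0≤x x≤y y≤ln k = ≤-trans (expPartial-mono-≤ 0≤x x≤y k) (y≤ln k)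

  expTerm≤expPartial : 0ℚ ≤ x → ∀ k → expTerm x k ≤ expPartial x k
  expTerm≤expPartial 0≤x zero    = ≤-refl
  expTerm≤expPartial {x} 0≤x (suc k) =
    subst (_≤ expPartial x (suc k)) (+-identityˡ (expTerm x (suc k)))
      (+-mono-≤ (expPartial-nonNeg 0≤x k) ≤-refl)

  ≤ln⇒expTerm≤ : ∀ {n} → 0ℚ ≤ x → x ≤ln n → ∀ k → expTerm x k ≤ fromℕ n
  ≤ln⇒expTerm≤ 0≤x x≤ln k = ≤-trans (expTerm≤expPartial 0≤x k) (x≤ln k)

  expTerm-two : ∀ x → expTerm x 2 ≡ x * x * recipℕ 2
  expTerm-two x = cong (λ e → e * x * recipℕ 2) (trans (*-identityʳ (1ℚ * x)) (*-identityˡ x))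

module Arithmetic where

  open import Data.Nat
  open import Data.Nat.Properties
  open import Data.Nat.Tactic.RingSolver using (solve-∀)
  open import Relation.Binary.PropositionalEquality using (_≡_; sym; cong)
  open import Relation.Nullary using (yes; no; contradiction)
  open import Relation.Nullary.Decidable using (from-no)

  _⁴ : ℕ → ℕ
  x ⁴ = x * x * (x * x)

  ⁴-mono-≤ : ∀ {a b} → a ≤ b → a ⁴ ≤ b ⁴
  ⁴-mono-≤ a≤b = *-mono-≤ (*-mono-≤ a≤b a≤b) (*-mono-≤ a≤b a≤b)

  ⁴-distrib-* : ∀ a b → (a * b) ⁴ ≡ a ⁴ * b ⁴
  ⁴-distrib-* = expanded
    where
    expanded : ∀ a b → a * b * (a * b) * (a * b * (a * b)) ≡ a * a * (a * a) * (b * b * (b * b))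
    expanded = solve-∀

  private
    n⁴≡n*n³ : ∀ n → n ⁴ ≡ n * (n * n * n)
    n⁴≡n*n³ = expanded
      where
      expanded : ∀ n → n * n * (n * n) ≡ n * (n * n * n)
      expanded = solve-∀

    regroup-cube : ∀ a b n → a * n * (b * n * (b * n)) ≡ a * b * b * (n * n * n)
    regroup-cube = solve-∀

  [11n]⁴-lower : ∀ {n} → 20000 ≤ n → 11 ⁴ * 20000 * (n * n * n) ≤ (11 * n) ⁴
  [11n]⁴-lower {n} n≥ = begin
    11 ⁴ * 20000 * (n * n * n)    ≡⟨ *-assoc (11 ⁴) 20000 (n * n * n) ⟩
    11 ⁴ * (20000 * (n * n * n))  ≤⟨ *-monoʳ-≤ (11 ⁴) (*-monoˡ-≤ (n * n * n) n≥) ⟩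
    11 ⁴ * (n * (n * n * n))      ≡⟨ cong (11 ⁴ *_) (n⁴≡n*n³ n) ⟨
    11 ⁴ * n ⁴                    ≡⟨ ⁴-distrib-* 11 n ⟨
    (11 * n) ⁴                    ∎
    where open ≤-Reasoning

  [27t]⁴-upper : ∀ {t n} → t ⁴ ≤ 2 * n * (16 * n * (16 * n)) → (27 * t) ⁴ ≤ 27 ⁴ * 512 * (n * n * n)
  [27t]⁴-upper {t} {n} t⁴≤ = begin
    (27 * t) ⁴                            ≡⟨ ⁴-distrib-* 27 t ⟩
    27 ⁴ * t ⁴                            ≤⟨ *-monoʳ-≤ (27 ⁴) t⁴≤ ⟩
    27 ⁴ * (2 * n * (16 * n * (16 * n)))  ≡⟨ cong (27 ⁴ *_) (regroup-cube 2 16 n) ⟩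
    27 ⁴ * (512 * (n * n * n))            ≡⟨ *-assoc (27 ⁴) 512 (n * n * n) ⟨
    27 ⁴ * 512 * (n * n * n)              ∎
    where open ≤-Reasoning

  -- With t⁴ ≤ 512 n³, t / n ≤ (512 / n)^¼, which is below 11/27 once n ≥ 20000.
  27t≤11n : ∀ {t n} → 20000 ≤ n → t ⁴ ≤ 2 * n * (16 * n * (16 * n)) → 27 * t ≤ 11 * n
  27t≤11n {t} {n} n≥ t⁴≤ with 27 * t ≤? 11 * n
  ... | yes 27t≤11n = 27t≤11n
  ... | no  27t≰11n = contradiction
    (*-cancelʳ-≤ (11 ⁴ * 20000) (27 ⁴ * 512) (n * n * n) {{n³≢0}}
      (≤-trans ([11n]⁴-lower n≥) (≤-trans (⁴-mono-≤ (<⇒≤ (≰⇒> 27t≰11n))) ([27t]⁴-upper {t} {n} t⁴≤))))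
    (from-no (11 ⁴ * 20000 ≤? 27 ⁴ * 512))
    where
    n³≢0 : NonZero (n * n * n)
    n³≢0 = >-nonZero (*-mono-≤ (*-mono-≤ n>0 n>0) n>0)
      where n>0 = ≤-trans (s≤s z≤n) n≥

  8n≤27[n∸a] : ∀ {n a T} → 2 * a ≤ n + T → 27 * T ≤ 11 * n → 8 * n ≤ 27 * (n ∸ a)
  8n≤27[n∸a] {n} {a} {T} 2a≤n+T 27T≤11n = begin
    8 * n                  ≡⟨ m+n∸n≡m (8 * n) (19 * n) ⟨
    8 * n + 19 * n ∸ 19 * n ≡⟨ cong (_∸ 19 * n) (sym (*-distribʳ-+ n 8 19)) ⟩
    27 * n ∸ 19 * n        ≤⟨ ∸-monoʳ-≤ (27 * n) 27a≤19n ⟩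
    27 * n ∸ 27 * a        ≡⟨ *-distribˡ-∸ 27 n a ⟨
    27 * (n ∸ a)           ∎
    where
    open ≤-Reasoning
    27a≤19n : 27 * a ≤ 19 * n
    27a≤19n = *-cancelˡ-≤ 2 (begin
      2 * (27 * a)     ≡⟨ *-comm-middle 2 27 a ⟩
      27 * (2 * a)     ≤⟨ *-monoʳ-≤ 27 2a≤n+T ⟩
      27 * (n + T)     ≡⟨ *-distribˡ-+ 27 n T ⟩
      27 * n + 27 * T  ≤⟨ +-monoʳ-≤ (27 * n) 27T≤11n ⟩
      27 * n + 11 * n  ≡⟨ *-distribʳ-+ n 27 11 ⟨
      38 * n           ≡⟨ *-assoc 2 19 n ⟩
      2 * (19 * n)     ∎)
      where
      *-comm-middle : ∀ a b c → a * (b * c) ≡ b * (a * c)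
      *-comm-middle = solve-∀

  4Ln≤27sTF : ∀ {L N n s T F} → L * N ≤ s * (T + T) * F → 8 * n ≤ 27 * N → 4 * (L * n) ≤ 27 * (s * T * F)
  4Ln≤27sTF {L} {N} {n} {s} {T} {F} LN≤ 8n≤27N = *-cancelˡ-≤ 2 (begin
    2 * (4 * (L * n))       ≡⟨ regroupˡ L n ⟩
    L * (8 * n)             ≤⟨ *-monoʳ-≤ L 8n≤27N ⟩
    L * (27 * N)            ≡⟨ *-comm-middle L 27 N ⟩
    27 * (L * N)            ≤⟨ *-monoʳ-≤ 27 LN≤ ⟩
    27 * (s * (T + T) * F)  ≡⟨ regroupʳ s T F ⟩
    2 * (27 * (s * T * F))  ∎)
    where
    open ≤-Reasoning
    regroupˡ : ∀ L n → 2 * (4 * (L * n)) ≡ L * (8 * n)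
    regroupˡ = solve-∀
    *-comm-middle : ∀ a b c → a * (b * c) ≡ b * (a * c)
    *-comm-middle = solve-∀
    regroupʳ : ∀ s T F → 27 * (s * (T + T) * F) ≡ 2 * (27 * (s * T * F))
    regroupʳ = solve-∀

module HittingProbability where

  open import Defs using (fromℕ; recipℕ; expTerm; _≤ln_; InWide; InUStar; isFullChain; numFullChains)
  open Lists using (reduce⁺; ∈-reduce)
  open Subsets using (dist; 2∣p∣≤n+dist)
  open Fractions
  open ExponentialSeries
  open Arithmetic
  open import Data.Nat as ℕ using (ℕ; _+_; _*_; _∸_; NonZero; >-nonZero; z≤n; s≤s)
  open import Data.Nat.Properties as ℕ using (*-mono-≤; m*n≢0; +-monoʳ-≤)
  open import Data.Nat.Tactic.RingSolver using (solve-∀)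
  open import Data.Rational as ℚ using (0ℚ; _≤_)
  open import Data.Rational.Properties using (module ≤-Reasoning)
  open import Data.Fin.Subset using (_⊆_; ∣_∣)
  open import Data.List using (length; _++_)
  open import Data.List.Membership.Propositional.Properties using (∈-++⁺ʳ; ∈-lookup)
  open import Data.List.Relation.Unary.All using (All; reduce)
  import Data.List.Relation.Unary.All as All
  import Data.List.Relation.Unary.All.Properties as All
  open import Data.List.Relation.Unary.Any using (Any)
  import Data.List.Relation.Unary.Any as Any
  open import Data.List.Relation.Unary.Any.Properties using (lookup-result)
  open import Data.List.Relation.Unary.Unique.Propositional using (Unique)
  open import Data.List.Extrema ℕ.≤-totalOrder using (argmax; argmax-all; f[⊥]≤f[argmax]; f[xs]≤f[argmax])
  open import Data.Bool using (true)
  open import Data.Product using (∃-syntax; _×_; _,_; proj₁; proj₂)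
  open import Function using (_∘_)
  open import Relation.Nullary using (¬_)
  open import Relation.Binary.PropositionalEquality using (_≡_; refl; sym; cong; cong₂; subst; subst₂; module ≡-Reasoning)

  ≤ln⇒square≤ : ∀ {a m n} .{{_ : NonZero m}} → frac a m ≤ln n → a * a ℕ.≤ 2 * n * (m * m)
  ≤ln⇒square≤ {a} {m} {n} a/m≤ln = subst₂ ℕ._≤_ (lhs a) (rhs n m)
    (frac-≤⁻ {a * a * 1} {m * m * 2} {n} {1} {{m*n≢0 (m * m) 2 {{m*n≢0 m m}}}} (begin
      frac (a * a * 1) (m * m * 2)        ≡⟨ frac-* (a * a) (m * m) 1 2 ⟨
      frac (a * a) (m * m) ℚ.* frac 1 2   ≡⟨ cong₂ ℚ._*_ (frac-* a m a m) (recipℕ≡frac 2) ⟨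
      frac a m ℚ.* frac a m ℚ.* recipℕ 2  ≡⟨ expTerm-two (frac a m) ⟨
      expTerm (frac a m) 2                ≤⟨ ≤ln⇒expTerm≤ {n = n} (frac-nonNeg a m) a/m≤ln 2 ⟩
      fromℕ n                             ≡⟨ fromℕ≡frac n ⟩
      frac n 1                            ∎))
    where
    open ≤-Reasoning
    lhs : ∀ a → a * a * 1 * 1 ≡ a * a
    lhs = solve-∀
    rhs : ∀ n m → n * (m * m * 2) ≡ 2 * n * (m * m)
    rhs = solve-∀

  ratio≡frac : ∀ L F n M →
    frac L F ℚ.* frac L F ℚ.* fromℕ n ℚ.* recipℕ M ≡ frac (L * L * n * 1) (F * F * 1 * M)
  ratio≡frac L F n M = begin
    frac L F ℚ.* frac L F ℚ.* fromℕ n ℚ.* recipℕ M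
      ≡⟨ cong₂ (λ x y → frac L F ℚ.* frac L F ℚ.* x ℚ.* y) (fromℕ≡frac n) (recipℕ≡frac M) ⟩
    frac L F ℚ.* frac L F ℚ.* frac n 1 ℚ.* frac 1 M
      ≡⟨ cong (λ x → x ℚ.* frac n 1 ℚ.* frac 1 M) (frac-* L F L F) ⟩
    frac (L * L) (F * F) ℚ.* frac n 1 ℚ.* frac 1 M
      ≡⟨ cong (ℚ._* frac 1 M) (frac-* (L * L) (F * F) n 1) ⟩
    frac (L * L * n) (F * F * 1) ℚ.* frac 1 M
      ≡⟨ frac-* (L * L * n) (F * F * 1) 1 M ⟩
    frac (L * L * n * 1) (F * F * 1 * M)
      ∎
    where open ≡-Reasoning

  hitting-ratio≤ : ∀ {L N n s T F} .{{_ : NonZero n}} → L * N ℕ.≤ s * (T + T) * F → 8 * n ℕ.≤ 27 * N →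
    frac L F ℚ.* frac L F ℚ.* fromℕ n ℚ.* recipℕ (729 * s * s) ≤ frac (T * T) (16 * n)
  hitting-ratio≤ {L} {N} {n} {s} {T} {F} LN≤ 8n≤27N = begin
    frac L F ℚ.* frac L F ℚ.* fromℕ n ℚ.* recipℕ (729 * s * s)  ≡⟨ ratio≡frac L F n (729 * s * s) ⟩
    frac (L * L * n * 1) (F * F * 1 * (729 * s * s))
      ≤⟨ frac-≤⁺ {L * L * n * 1} {F * F * 1 * (729 * s * s)} {T * T} {16 * n} {{m*n≢0 16 n}} cross ⟩
    frac (T * T) (16 * n)                                 ∎
    where
    open ≤-Reasoning
    root : 4 * (L * n) ℕ.≤ 27 * (s * T * F)
    root = 4Ln≤27sTF {L} {N} {n} {s} {T} {F} LN≤ 8n≤27N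
    lhs : ∀ k L n → k * (L * n) * (k * (L * n)) ≡ L * L * n * 1 * (k * k * n)
    lhs = solve-∀
    rhs : ∀ k s T F → k * (s * T * F) * (k * (s * T * F)) ≡ T * T * (F * F * 1 * (k * k * s * s))
    rhs = solve-∀
    cross : L * L * n * 1 * (16 * n) ℕ.≤ T * T * (F * F * 1 * (729 * s * s))
    cross = subst₂ ℕ._≤_ (lhs 4 L n) (rhs 27 s T F) (*-mono-≤ root root)

  wide-radius : ∀ {n} (v : Subset n) (us : List (Subset n)) → InWide n v → All (InWide n) us →
    ∃[ T ] frac (T * T) (16 * n) ≤ln n × dist v ℕ.≤ T × All (λ u → dist u ℕ.≤ T) us
  wide-radius v us v-wide us-wide =
    dist top , argmax-all dist v-wide us-wide , f[⊥]≤f[argmax] {f = dist} v us , f[xs]≤f[argmax] {f = dist} v us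
    where top = argmax dist v us

  InUStar⇒InWide : ∀ {n v S u} → InUStar n v S u → InWide n u
  InUStar⇒InWide (_ , _ , _ , u-wide) = u-wide

  hitting-bound : ∀ {n s} {v : Subset n} {S L} → 20000 ℕ.≤ n → InWide n v → length S ≡ s →
    All (InWide n) S → All (λ w → ¬ w ⊆ v) S → Unique L →
    All (λ c → isFullChain v c ≡ true × Any (InUStar n v S) c) L →
    (frac (length L) (numFullChains n v) ℚ.* frac (length L) (numFullChains n v) ℚ.* fromℕ n
      ℚ.* recipℕ (729 * s * s)) ≤ln n
  hitting-bound {n} {v = v} {S} {L} n≥ v-wide refl S-wide S⊈v L! hits =
    ≤-≤ln-trans {n = n} (subst (0ℚ ≤_) (sym (ratio≡frac |L| F n M)) (frac-nonNeg (|L| * |L| * n * 1) (F * F * 1 * M)))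
      (hitting-ratio≤ {|L|} {n ∸ ∣ v ∣} {n} {length S} {T} {F} count
        (8n≤27[n∸a] {n} {∣ v ∣} {T} 2∣v∣≤n+T 27T≤11n))
      T-wide
    where
    instance
      n≢0 : NonZero n
      n≢0 = >-nonZero (ℕ.≤-trans (s≤s z≤n) n≥)
    |L| = length L
    F = numFullChains n v
    M = 729 * length S * length S
    witnesses = reduce (Any.lookup ∘ proj₂) hits
    radius = wide-radius v (S ++ witnesses) v-wide
      (All.++⁺ S-wide (reduce⁺ (Any.lookup ∘ proj₂) (InUStar⇒InWide ∘ lookup-result ∘ proj₂) hits))
    T : ℕ
    T = proj₁ radius
    T-wide : frac (T * T) (16 * n) ≤ln n
    T-wide = proj₁ (proj₂ radius)
    v-near : dist v ℕ.≤ T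
    v-near = proj₁ (proj₂ (proj₂ radius))
    near : All (λ u → dist u ℕ.≤ T) (S ++ witnesses)
    near = proj₂ (proj₂ (proj₂ radius))
    2∣v∣≤n+T : 2 * ∣ v ∣ ℕ.≤ n + T
    2∣v∣≤n+T = ℕ.≤-trans (2∣p∣≤n+dist v) (+-monoʳ-≤ n v-near)
    27T≤11n : 27 * T ℕ.≤ 11 * n
    27T≤11n = 27t≤11n {T} {n} n≥ (≤ln⇒square≤ {T * T} {16 * n} {n} {{m*n≢0 16 n}} T-wide)
    hit-near : ∀ {c} (h : isFullChain v c ≡ true × Any (InUStar n v S) c) → dist (Any.lookup (proj₂ h)) ℕ.≤ T →
      isFullChain v c ≡ true × HittingChains.Hit v S T c
    hit-near (full , hit) near-u =
      let _ , u≢v , comparable , _ = lookup-result hit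
      in  full , Any.lookup hit , ∈-lookup (Any.index hit) , u≢v , near-u , comparable
    hits′ : All (λ c → isFullChain v c ≡ true × HittingChains.Hit v S T c) L
    hits′ = All.tabulate λ c∈L →
      hit-near (All.lookup hits c∈L) (All.lookup near (∈-++⁺ʳ S (∈-reduce (Any.lookup ∘ proj₂) hits c∈L)))
    count = HittingChains.hitting-count v S T v-near (All.++⁻ˡ S near) S⊈v {L} L! hits′

open import Defs
open import Data.Nat using (ℕ; _≤_)
open import Data.Bool using (true)
open import Data.Product using (_×_; ∃-syntax; _,_)
open import Data.List using (List; length)
open import Data.List.Relation.Unary.All using (All)
open import Data.List.Relation.Unary.Any using (Any)
open import Data.List.Relation.Unary.Unique.Propositional using (Unique)
open import Data.Fin.Subset using (Subset; _⊆_)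
open import Relation.Nullary using (¬_)
open import Relation.Binary.PropositionalEquality using (_≡_)
open import Data.Rational using (_*_)
import Data.Nat as N
open HittingProbability using (hitting-bound)

lemma3p2 : (s : ℕ) → 1 ≤ s →
    ∃[ n₀ ] ((n : ℕ) → n₀ ≤ n →
      (v : Subset n) → InWide n v →
      (S : List (Subset n)) → Unique S → length S ≡ s →
      All (InWide n) S → All (λ w → ¬ (w ⊆ v)) S →
      (L : List (List (Subset n))) → Unique L →
      All (λ c → (isFullChain v c ≡ true) × Any (InUStar n v S) c) L →
      ((fromℕ (length L) * recipℕ (numFullChains n v))
        * (fromℕ (length L) * recipℕ (numFullChains n v))
        * fromℕ n * recipℕ (729 N.* s N.* s)) ≤ln n)
lemma3p2 s _ = 20000 , λ n n≥ v v-wide S _ |S|≡s S-wide S⊈v L L! hits →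
  hitting-bound n≥ v-wide |S|≡s S-wide S⊈v L! hits
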